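{- If $ n $ is a non-negative integer, then $$ F(n) = \left \lfloor \frac{3^{n^2 + n}}{\max\left(3^{2n} - ( 3^n + 1 ),\, 0\right)} \right \rfloor \bmod 3^n . $$
   Context: $F(n)$ is the Fibonacci sequence: $F(0)=0$, $F(1)=1$, $F(n+2)=F(n+1)+F(n)$ for $n\ge 0$. The expression $\max(x-y,0)$ is the truncated subtraction. Conventions: $\lfloor x/0\rfloor = 0$ and $x \bmod 1 = 0$ (used for $n=0$). -}

module Defs where

open import Data.Nat using (ℕ; zero; suc; _+_; _∸_)
import Data.Nat.DivMod as DM

fib : ℕ → ℕ
fib zero = 0
fib (suc zero) = 1
fib (suc (suc n)) = fib (suc n) + fib n

_div₀_ : ℕ → ℕ → ℕ
x div₀ zero = 0
x div₀ suc d = x DM./ suc d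

-- total remainder with convention x mod 0 = x (never used here since 3^n ≥ 1)
_mod₀_ : ℕ → ℕ → ℕ
x mod₀ zero = x
x mod₀ suc d = x DM.% suc d

-- Since 1/(x² − x − 1) = Σₖ F(k) x^(−k−1), the integer part of x^(n+1)/(x² − x − 1) is the
-- base-x numeral with digits F(1), …, F(n): indeed x^(n+1) ≡ F(n+1) x + F(n) modulo x² − x − 1,
-- and this remainder is smaller than x² − x − 1 as soon as F(n+1) + 2 ≤ x. Its last digit, i.e.
-- its residue modulo x, is F(n). For x = 3ⁿ the digits are small enough for every n ≥ 1.
module Submission where

open import Defs
open import Data.Nat using (ℕ; zero; suc; _+_; _*_; _∸_; _^_; _≤_; _<_; z≤n; z<s; NonZero; >-nonZero)
open import Data.Nat.Properties
open import Data.Nat.DivMod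
open import Data.Nat.Divisibility using (n∣m*n)
open import Data.Nat.Solver using (module +-*-Solver)
open import Relation.Binary.PropositionalEquality using (_≡_; refl; sym; trans; cong; cong₂; module ≡-Reasoning)

open +-*-Solver

[m*n+o]/n≡m : ∀ m {n o} .{{_ : NonZero n}} → o < n → (m * n + o) / n ≡ m
[m*n+o]/n≡m m {n} {o} o<n = begin
  (m * n + o) / n      ≡⟨ +-distrib-/-∣ˡ o (n∣m*n m) ⟩
  m * n / n + o / n    ≡⟨ cong₂ _+_ (m*n/n≡m m n) (m<n⇒m/n≡0 o<n) ⟩
  m + 0                ≡⟨ +-identityʳ m ⟩
  m                    ∎
  where open ≡-Reasoning

m^[n*n+n]≡[m^n]^[1+n] : ∀ m n → m ^ (n * n + n) ≡ (m ^ n) ^ suc n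
m^[n*n+n]≡[m^n]^[1+n] m n = begin
  m ^ (n * n + n)  ≡⟨ cong (m ^_) (trans (+-comm (n * n) n) (sym (*-suc n n))) ⟩
  m ^ (n * suc n)  ≡⟨ ^-*-assoc m n (suc n) ⟨
  (m ^ n) ^ suc n  ∎
  where open ≡-Reasoning

m^[2*n]≡m^n*m^n : ∀ m n → m ^ (2 * n) ≡ m ^ n * m ^ n
m^[2*n]≡m^n*m^n m n = trans (cong (λ k → m ^ (n + k)) (+-identityʳ n)) (^-distribˡ-+-* m n n)

fib-mono : ∀ n → fib n ≤ fib (suc n)
fib-mono zero    = z≤n
fib-mono (suc n) = m≤m+n (fib (suc n)) (fib n)

fib[2+n]+2≤3^[1+n] : ∀ n → fib (suc (suc n)) + 2 ≤ 3 ^ suc n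
fib[2+n]+2≤3^[1+n] zero    = ≤-refl
fib[2+n]+2≤3^[1+n] (suc n) = begin
  fib (suc (suc n)) + fib (suc n) + 2      ≤⟨ +-monoˡ-≤ 2 (+-monoʳ-≤ a (fib-mono (suc n))) ⟩
  a + a + 2                                ≤⟨ +-monoʳ-≤ (a + a) (m≤m+n 2 2) ⟩
  a + a + 4                                ≡⟨ solve 1 (λ a → a :+ a :+ con 4 := con 2 :* (a :+ con 2)) refl a ⟩
  2 * (a + 2)                              ≤⟨ *-monoʳ-≤ 2 (fib[2+n]+2≤3^[1+n] n) ⟩
  2 * 3 ^ suc n                            ≤⟨ *-monoˡ-≤ (3 ^ suc n) (m≤m+n 2 1) ⟩
  3 * 3 ^ suc n                            ∎
  where
  open ≤-Reasoning
  a = fib (suc (suc n))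

suc[a*x+b]+[x+1]≤x*x : ∀ {a b x} → b ≤ a → a + 2 ≤ x → suc (a * x + b) + (x + 1) ≤ x * x
suc[a*x+b]+[x+1]≤x*x {a} {b} {x} b≤a a+2≤x = begin
  suc (a * x + b) + (x + 1)  ≡⟨ solve 3 (λ a b x → con 1 :+ (a :* x :+ b) :+ (x :+ con 1) := a :* x :+ x :+ (b :+ con 2)) refl a b x ⟩
  a * x + x + (b + 2)        ≤⟨ +-monoʳ-≤ (a * x + x) (≤-trans (+-monoˡ-≤ 2 b≤a) a+2≤x) ⟩
  a * x + x + x              ≡⟨ solve 2 (λ a x → a :* x :+ x :+ x := (a :+ con 2) :* x) refl a x ⟩
  (a + 2) * x                ≤⟨ *-monoˡ-≤ x a+2≤x ⟩
  x * x                      ∎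
  where open ≤-Reasoning

fibNumeral : ℕ → ℕ → ℕ
fibNumeral x zero    = 0
fibNumeral x (suc n) = x * fibNumeral x n + fib (suc n)

^-fibNumeral-expansion : ∀ {x D} → x * x ≡ D + (x + 1) → ∀ n →
                         x ^ suc n ≡ fibNumeral x n * D + (fib (suc n) * x + fib n)
^-fibNumeral-expansion {x} {D} x²≡D+x+1 zero    = solve 2 (λ x D → x :* con 1 := con 0 :* D :+ (con 1 :* x :+ con 0)) refl x D
^-fibNumeral-expansion {x} {D} x²≡D+x+1 (suc n) = begin
  x * x ^ suc n                         ≡⟨ cong (x *_) (^-fibNumeral-expansion x²≡D+x+1 n) ⟩
  x * (q * D + (a * x + b))             ≡⟨ solve 5 (λ x q D a b → x :* (q :* D :+ (a :* x :+ b)) := x :* q :* D :+ b :* x :+ a :* (x :* x)) refl x q D a b ⟩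
  x * q * D + b * x + a * (x * x)       ≡⟨ cong (λ t → x * q * D + b * x + a * t) x²≡D+x+1 ⟩
  x * q * D + b * x + a * (D + (x + 1)) ≡⟨ solve 5 (λ x q D a b → x :* q :* D :+ b :* x :+ a :* (D :+ (x :+ con 1)) := (x :* q :+ a) :* D :+ ((a :+ b) :* x :+ a)) refl x q D a b ⟩
  (x * q + a) * D + ((a + b) * x + a)   ∎
  where
  open ≡-Reasoning
  q = fibNumeral x n
  a = fib (suc n)
  b = fib n

fibNumeral%x≡fib%x : ∀ x .{{_ : NonZero x}} n → fibNumeral x n % x ≡ fib n % x
fibNumeral%x≡fib%x x zero    = refl
fibNumeral%x≡fib%x x (suc n) = begin
  (x * q + a) % x  ≡⟨ cong (_% x) (trans (+-comm (x * q) a) (cong (a +_) (*-comm x q))) ⟩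
  (a + q * x) % x  ≡⟨ [m+kn]%n≡m%n a q x ⟩
  a % x            ∎
  where
  open ≡-Reasoning
  q = fibNumeral x n
  a = fib (suc n)

fib≡[x^[1+n]/D]%x : ∀ n {x D} .{{_ : NonZero x}} .{{_ : NonZero D}} → x * x ≡ D + (x + 1) →
                    fib (suc n) * x + fib n < D → fib n < x → fib n ≡ (x ^ suc n / D) % x
fib≡[x^[1+n]/D]%x n {x} {D} x²≡D+x+1 r<D fib<x = sym (begin
  (x ^ suc n / D) % x                       ≡⟨ cong (λ t → (t / D) % x) (^-fibNumeral-expansion x²≡D+x+1 n) ⟩
  ((fibNumeral x n * D + r) / D) % x        ≡⟨ cong (_% x) ([m*n+o]/n≡m (fibNumeral x n) r<D) ⟩
  fibNumeral x n % x                        ≡⟨ fibNumeral%x≡fib%x x n ⟩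
  fib n % x                                 ≡⟨ m<n⇒m%n≡m fib<x ⟩
  fib n                                     ∎)
  where
  open ≡-Reasoning
  r = fib (suc n) * x + fib n

[m/₀n]%₀o≡[m/n]%o : ∀ m {n o} .{{_ : NonZero n}} .{{_ : NonZero o}} → (m div₀ n) mod₀ o ≡ (m / n) % o
[m/₀n]%₀o≡[m/n]%o m {suc _} {suc _} = refl

fib≡[x^[1+n]/[x²∸[x+1]]]%x : ∀ n {x} → fib (suc n) + 2 ≤ x →
                              fib n ≡ ((x ^ suc n) div₀ (x * x ∸ (x + 1))) mod₀ x
fib≡[x^[1+n]/[x²∸[x+1]]]%x n {x} fib[1+n]+2≤x = begin
  fib n                     ≡⟨ fib≡[x^[1+n]/D]%x n x²≡D+x+1 r<D fib<x ⟩
  (x ^ suc n / D) % x       ≡⟨ [m/₀n]%₀o≡[m/n]%o (x ^ suc n) {D} {x} ⟨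
  ((x ^ suc n) div₀ D) mod₀ x ∎
  where
  open ≡-Reasoning
  D = x * x ∸ (x + 1)
  r = fib (suc n) * x + fib n
  r+x+1<x² : suc r + (x + 1) ≤ x * x
  r+x+1<x² = suc[a*x+b]+[x+1]≤x*x (fib-mono n) fib[1+n]+2≤x
  x²≡D+x+1 : x * x ≡ D + (x + 1)
  x²≡D+x+1 = sym (m∸n+n≡m (m+n≤o⇒n≤o (suc r) r+x+1<x²))
  r<D : r < D
  r<D = m+n≤o⇒m≤o∸n (suc r) r+x+1<x²
  fib<x : fib n < x
  fib<x = ≤-<-trans (fib-mono n) (<-≤-trans (m<m+n (fib (suc n)) z<s) fib[1+n]+2≤x)
  instance
    D≢0 : NonZero D
    D≢0 = >-nonZero (≤-<-trans z≤n r<D)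
    x≢0 : NonZero x
    x≢0 = >-nonZero (≤-<-trans z≤n fib<x)

corollary6p6 : (n : ℕ) →
    fib n ≡ ((3 ^ (n * n + n)) div₀ ((3 ^ (2 * n)) ∸ (3 ^ n + 1))) mod₀ (3 ^ n)
corollary6p6 zero    = refl
corollary6p6 (suc m) rewrite m^[n*n+n]≡[m^n]^[1+n] 3 (suc m) | m^[2*n]≡m^n*m^n 3 (suc m) =
  fib≡[x^[1+n]/[x²∸[x+1]]]%x (suc m) (fib[2+n]+2≤3^[1+n] m)
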